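{- Let $C$ be a geometric precubical set, $n\ge3$ and $u\in\{ -,+\}^n$. Then every morphism $\Lambda^u\to C$ has at most one extension along the canonical inclusion $\Lambda^u\hookrightarrow\partial Yn$ to a morphism $\partial Yn\to C$.
   Context: A precubical set $C$: sets $C(n)$ with faces $\partial^\epsilon_{i,n}:C(n+1)\to C(n)$ ($\epsilon\in\{ -,+\}$, $0\le i\le n$) satisfying $\partial^\epsilon_{j,n}\partial^{\epsilon'}_{i,n+1}=\partial^{\epsilon'}_{i,n}\partial^\epsilon_{j+1,n+1}$ for $i\le j$; equivalently a presheaf on the precubical category $\square$ generated by $\varepsilon^\epsilon_{i,n}:n\to n+1$ subject to $\varepsilon^{\epsilon'}_{i,n+1}\varepsilon^\epsilon_{j,n}=\varepsilon^\epsilon_{j+1,n+1}\varepsilon^{\epsilon'}_{i,n}$ for $i\le j$. Iterated faces of $c\in C(n)$: $C(\phi)(c)$ for $\phi:m\to n$ in $\square$. $C$ is geometric if (1) for $c\in C(n)$ and $\phi,\psi:m\to n$, $C(\phi)(c)=C(\psi)(c)$ implies $\phi=\psi$, and (2) any two cubes admitting a common iterated face admit a maximal common iterated face. Standard $n$-cube $Yn$: strings in $\{ -,0,+\}^n$, $k$-cubes having exactly $k$ zeros, $\partial^\epsilon_i$ replacing the $i$-th zero by $\epsilon$; $\partial Yn=Yn\setminus\{0^n\}$; for $u\in\{ -,+\}^n$, $\Lambda^u\subseteq\partial Yn$ consists of strings $v\ne0^n$ with $v_i=u_i$ for some $i$. -}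

module Defs where

open import Level using (Level; _⊔_; 0ℓ) renaming (suc to lsuc)
open import Data.Nat using (ℕ; zero; suc; _≤_)
open import Data.Fin using (Fin; zero; suc; inject₁; toℕ)
open import Data.Bool using (Bool; true; false; T; _∨_; not)
open import Data.Unit using (tt)
open import Data.Vec using (Vec; []; _∷_)
open import Data.Product using (Σ; _,_; proj₁; proj₂; ∃-syntax; _×_)
open import Relation.Binary.PropositionalEquality

data Sign : Set where
  minus plus : Sign

-- The precubical category □ : objects ℕ, generated by
--   ε^ε_{i,n} : n → n+1  (0 ≤ i ≤ n)
-- subject to  ε^{ε'}_{i,n+1} ε^ε_{j,n} = ε^ε_{j+1,n+1} ε^{ε'}_{i,n}  (i ≤ j).
--
-- Hom m n : words in the generators (paths in the free category),
-- written as post-compositions of generators.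

data Hom : ℕ → ℕ → Set where
  idH : ∀ {n} → Hom n n
  -- ε s i φ  is the composite  ε^s_{i,n} ∘ φ  for φ : m → n
  εH  : ∀ {m n} → Sign → Fin (suc n) → Hom m n → Hom m (suc n)

-- Equality of morphisms in □: the congruence generated by the relations.
-- (Congruence w.r.t. post-composition is 'cong-ε'; w.r.t. pre-composition
-- is built in, since 'rel' allows an arbitrary tail β.)
infix 4 _≈H_
data _≈H_ : ∀ {m n} → Hom m n → Hom m n → Set where
  reflH  : ∀ {m n} {φ : Hom m n} → φ ≈H φ
  symH   : ∀ {m n} {φ ψ : Hom m n} → φ ≈H ψ → ψ ≈H φ
  transH : ∀ {m n} {φ ψ χ : Hom m n} → φ ≈H ψ → ψ ≈H χ → φ ≈H χ
  cong-ε : ∀ {m n} (s : Sign) (i : Fin (suc n)) {φ ψ : Hom m n} →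
           φ ≈H ψ → εH s i φ ≈H εH s i ψ
  rel    : ∀ {m n} (s s' : Sign) (i j : Fin (suc n)) → toℕ i ≤ toℕ j →
           (β : Hom m n) →
           εH s' (inject₁ i) (εH s j β) ≈H εH s (suc j) (εH s' i β)

record PrecubicalSet (ℓ : Level) : Set (lsuc ℓ) where
  field
    cell : ℕ → Set ℓ
    face : (n : ℕ) → Sign → Fin (suc n) → cell (suc n) → cell n
    face-rel : (n : ℕ) (s s' : Sign) (i j : Fin (suc n)) → toℕ i ≤ toℕ j →
               (c : cell (suc (suc n))) →
               face n s j (face (suc n) s' (inject₁ i) c)
                 ≡ face n s' i (face (suc n) s (suc j) c)

open PrecubicalSet public

act : ∀ {ℓ} (C : PrecubicalSet ℓ) {m n : ℕ} → Hom m n → cell C n → cell C m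
act C idH c = c
act C (εH {n = n} s i φ) c = act C φ (face C n s i c)

record Morphism {ℓ ℓ'} (C : PrecubicalSet ℓ) (D : PrecubicalSet ℓ') : Set (ℓ ⊔ ℓ') where
  field
    map  : (n : ℕ) → cell C n → cell D n
    comm : (n : ℕ) (s : Sign) (i : Fin (suc n)) (c : cell C (suc n)) →
           map n (face C n s i c) ≡ face D n s i (map (suc n) c)

open Morphism public

IsIterFace : ∀ {ℓ} (C : PrecubicalSet ℓ) {m n : ℕ} → cell C m → cell C n → Set ℓ
IsIterFace C {m} {n} z x = Σ (Hom m n) λ φ → act C φ x ≡ z

IsCommonFace : ∀ {ℓ} (C : PrecubicalSet ℓ) {m n n' : ℕ} →
               cell C m → cell C n → cell C n' → Set ℓ
IsCommonFace C z x y = IsIterFace C z x × IsIterFace C z y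

record Geometric {ℓ} (C : PrecubicalSet ℓ) : Set ℓ where
  field
    faces-distinct : {m n : ℕ} (c : cell C n) (φ ψ : Hom m n) →
                     act C φ c ≡ act C ψ c → φ ≈H ψ
    maximal-common : {n n' : ℕ} (x : cell C n) (y : cell C n') →
                     (∃[ m ] Σ (cell C m) λ z → IsCommonFace C z x y) →
                     ∃[ k ] Σ (cell C k) λ w →
                       IsCommonFace C w x y ×
                       ((m : ℕ) (z : cell C m) → IsCommonFace C z x y → IsIterFace C z w)

-- The standard n-cube Yn: strings in {-,0,+}^n; Cube k n is the set of
-- such strings of length n with exactly k zeros.

data Cube : ℕ → ℕ → Set where
  []  : Cube 0 0
  _∷0 : ∀ {k n} → Cube k n → Cube (suc k) (suc n)
  _∷s_ : ∀ {k n} → Sign → Cube k n → Cube k (suc n)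

-- note: constructor  w ∷0  means the string  0w ;  s ∷s w  means  s w.

-- ∂^ε_i : replace the i-th zero by ε
cubeFace : ∀ {k n} → Sign → Fin (suc k) → Cube (suc k) n → Cube k n
cubeFace s i       (t ∷s w) = t ∷s cubeFace s i w
cubeFace s zero    (w ∷0)   = s ∷s w
cubeFace {suc k} s (suc i) (w ∷0) = cubeFace s i w ∷0

private
  cubeFace-rel : ∀ {k n} (s s' : Sign) (i j : Fin (suc k)) → toℕ i ≤ toℕ j →
                 (c : Cube (suc (suc k)) n) →
                 cubeFace s j (cubeFace s' (inject₁ i) c)
                   ≡ cubeFace s' i (cubeFace s (suc j) c)
  cubeFace-rel s s' i j ij (t ∷s c) = cong (t ∷s_) (cubeFace-rel s s' i j ij c)
  cubeFace-rel s s' zero j ij (c ∷0) = refl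
  cubeFace-rel {suc k} s s' (suc i) (suc j) (Data.Nat.s≤s ij) (c ∷0) =
    cong _∷0 (cubeFace-rel s s' i j ij c)

Y : ℕ → PrecubicalSet 0ℓ
Y n = record
  { cell = λ k → Cube k n
  ; face = λ k s i c → cubeFace s i c
  ; face-rel = λ k s s' i j ij c → cubeFace-rel s s' i j ij c }

isAllZero : ∀ {k n} → Cube k n → Bool
isAllZero []       = true
isAllZero (w ∷0)   = isAllZero w
isAllZero (s ∷s w) = false

signEq : Sign → Sign → Bool
signEq minus minus = true
signEq plus  plus  = true
signEq _     _     = false

hasAgreement : ∀ {k n} → Vec Sign n → Cube k n → Bool
hasAgreement []      []       = false
hasAgreement (_ ∷ u) (w ∷0)   = hasAgreement u w
hasAgreement (a ∷ u) (s ∷s w) = signEq a s ∨ hasAgreement u w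

in∂ : ∀ {k n} → Cube k n → Bool
in∂ v = not (isAllZero v)

inΛ : ∀ {k n} → Vec Sign n → Cube k n → Bool
inΛ u v = in∂ v Data.Bool.∧ hasAgreement u v

private
  T-irr : (b : Bool) (p q : T b) → p ≡ q
  T-irr true tt tt = refl

  Σ-≡ : ∀ {A : Set} (P : A → Bool) {a a' : A} {p : T (P a)} {p' : T (P a')} →
        a ≡ a' → _≡_ {A = Σ A (λ x → T (P x))} (a , p) (a' , p')
  Σ-≡ P {a} {p = p} {p'} refl = cong (a ,_) (T-irr (P a) p p')

record SubCube (n : ℕ) : Set where
  field
    mem : ∀ {k} → Cube k n → Bool
    closed : ∀ {k} (s : Sign) (i : Fin (suc k)) (v : Cube (suc k) n) →
             T (mem v) → T (mem (cubeFace s i v))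

Sub : ∀ {n} → SubCube n → PrecubicalSet 0ℓ
Sub {n} S = record
  { cell = λ k → Σ (Cube k n) (λ v → T (SubCube.mem S v))
  ; face = λ k s i c → cubeFace s i (proj₁ c) , SubCube.closed S s i (proj₁ c) (proj₂ c)
  ; face-rel = λ k s s' i j ij c →
      Σ-≡ (SubCube.mem S) (cubeFace-rel s s' i j ij (proj₁ c)) }

private
  ∨-T : ∀ a b → T b → T (a ∨ b)
  ∨-T true  b p = tt
  ∨-T false b p = p

  ∧-T : ∀ a b → T a → T b → T (a Data.Bool.∧ b)
  ∧-T true true _ _ = tt

  ∧-T₁ : ∀ a b → T (a Data.Bool.∧ b) → T a
  ∧-T₁ true b _ = tt

  ∧-T₂ : ∀ a b → T (a Data.Bool.∧ b) → T b
  ∧-T₂ true b p = p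

  face-in∂ : ∀ {k n} (s : Sign) (i : Fin (suc k)) (v : Cube (suc k) n) →
             T (in∂ (cubeFace s i v))
  face-in∂ s i (t ∷s v) = tt
  face-in∂ s zero (v ∷0) = tt
  face-in∂ {suc k} s (suc i) (v ∷0) = face-in∂ s i v

  face-agree : ∀ {k n} (u : Vec Sign n) (s : Sign) (i : Fin (suc k)) (v : Cube (suc k) n) →
               T (hasAgreement u v) → T (hasAgreement u (cubeFace s i (v)))
  face-agree (a ∷ u) s zero (v ∷0) p = ∨-T (signEq a s) _ p
  face-agree {suc k} (a ∷ u) s (suc i) (v ∷0) p = face-agree u s i v p
  face-agree (a ∷ u) s i (t ∷s v) p with signEq a t
  ... | true  = tt
  ... | false = face-agree u s i v p

  closedΛ : ∀ {n} (u : Vec Sign n) {k} (s : Sign) (i : Fin (suc k)) (v : Cube (suc k) n) →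
            T (inΛ u v) → T (inΛ u (cubeFace s i v))
  closedΛ u s i v p = ∧-T (in∂ (cubeFace s i v)) _ (face-in∂ s i v)
                        (face-agree u s i v (∧-T₂ (in∂ v) _ p))

∂Y : (n : ℕ) → PrecubicalSet 0ℓ
∂Y n = Sub {n} record { mem = in∂ ; closed = λ s i v _ → face-in∂ s i v }

Λ : (n : ℕ) → Vec Sign n → PrecubicalSet 0ℓ
Λ n u = Sub {n} record { mem = inΛ u ; closed = closedΛ u }

Λ⊆∂ : ∀ {n} (u : Vec Sign n) → Morphism (Λ n u) (∂Y n)
Λ⊆∂ u = record
  { map  = λ k c → proj₁ c , ∧-T₁ (in∂ (proj₁ c)) _ (proj₂ c)
  ; comm = λ k s i c → Σ-≡ in∂ refl }

_∘M_ : ∀ {ℓ₁ ℓ₂ ℓ₃} {A : PrecubicalSet ℓ₁} {B : PrecubicalSet ℓ₂} {C : PrecubicalSet ℓ₃} →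
       Morphism B C → Morphism A B → Morphism A C
_∘M_ {A = A} {B} {C} g f = record
  { map  = λ k c → map g k (map f k c)
  ; comm = λ k s i c → trans (cong (map g k) (comm f k s i c)) (comm g k s i (map f (suc k) c)) }

Extends : ∀ {ℓ} {C : PrecubicalSet ℓ} {n : ℕ} (u : Vec Sign n) →
          Morphism (Λ n u) C → Morphism (∂Y n) C → Set ℓ
Extends {n = n} u f g = (k : ℕ) (c : cell (Λ n u) k) → map (g ∘M Λ⊆∂ u) k c ≡ map f k c

module Submission where

open import Defs
open import Level using (Level)
open import Data.Nat using (ℕ; zero; suc; _≤_; _<_; _+_; _∸_; z≤n; s≤s)
open import Data.Nat.Properties
  using (≤-refl; ≤-trans; <⇒≤; ≤-reflexive; m≤n⇒m≤1+n; 1+n≰n; +-suc; m≤n+m; m∸n+n≡m)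
open import Data.Fin using (Fin; zero; suc)
open import Data.Bool using (T)
open import Data.Bool.Properties using (T-irrelevant; T-∧; T-∨)
open import Data.Unit using (tt)
open import Data.Empty using (⊥-elim)
open import Data.Sum using (inj₁; inj₂)
open import Data.Product using (∃-syntax; _,_; proj₁)
open import Data.Vec using (Vec; _∷_)
open import Function.Bundles using (Equivalence)
open import Relation.Nullary using (¬_)
open import Relation.Binary.PropositionalEquality using (_≡_; _≢_; refl; sym; trans; cong)
open Relation.Binary.PropositionalEquality.≡-Reasoning

-- Two extensions g₁, g₂ of f agree on Λᵘ.  A top-dimensional cube c of ∂Yn
-- has, at each position i, a face ∂ᵉᵢ c in Λᵘ (take ε = uⱼ, j the coordinate
-- of the i-th zero of c); as n ≥ 3, c has two zeros, so g₁ c and g₂ c share a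
-- face at position 0 and one at position 1.  Let w be a maximal common face
-- of g₁ c and g₂ c; both shared faces are iterated faces of w.  By dimension,
-- either w = g₁ c = g₂ c, or w is equal to both shared faces — impossible in a
-- geometric precubical set, since ∂ᵉ₀ and ∂ᵉ'₁ are distinct in □.  Every
-- lower-dimensional cube of ∂Yn is an iterated face of a top-dimensional one.

Hom-dim-≤ : ∀ {m n} → Hom m n → m ≤ n
Hom-dim-≤ idH        = ≤-refl
Hom-dim-≤ (εH _ _ φ) = m≤n⇒m≤1+n (Hom-dim-≤ φ)

module _ {ℓ : Level} (C : PrecubicalSet ℓ) where

  act-resp-≈H : ∀ {m n} {φ ψ : Hom m n} → φ ≈H ψ → ∀ x → act C φ x ≡ act C ψ x
  act-resp-≈H reflH                       x = refl
  act-resp-≈H (symH p)                    x = sym (act-resp-≈H p x)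
  act-resp-≈H (transH p q)                x = trans (act-resp-≈H p x) (act-resp-≈H q x)
  act-resp-≈H (cong-ε {n = n} s i p)      x = act-resp-≈H p (face C n s i x)
  act-resp-≈H (rel {n = n} s s' i j ij β) x = cong (act C β) (face-rel C n s s' i j ij x)

  act-endo : ∀ {n} (φ : Hom n n) (x : cell C n) → act C φ x ≡ x
  act-endo idH        x = refl
  act-endo (εH _ _ φ) x = ⊥-elim (1+n≰n (Hom-dim-≤ φ))

  record Coface {k : ℕ} (c : cell C k) : Set ℓ where
    constructor coface
    field
      sign   : Sign
      index  : Fin (suc k)
      cube   : cell C (suc k)
      face≡c : face C k sign index cube ≡ c

  shared-face-common : ∀ {k} {s : Sign} {i : Fin (suc k)} {x x' : cell C (suc k)} →
                       face C k s i x ≡ face C k s i x' → IsCommonFace C (face C k s i x) x x'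
  shared-face-common {s = s} {i} eq = (εH s i idH , refl) , (εH s i idH , sym eq)

zeros : (n : ℕ) → Cube n n
zeros zero    = []
zeros (suc n) = zeros n ∷0

εH₀≉εH₁ : ∀ {n} (s t : Sign) → ¬ (εH {n = suc n} s zero idH ≈H εH t (suc zero) idH)
εH₀≉εH₁ s t p with act-resp-≈H (Y _) p (zeros _)
... | ()

module _ {ℓ : Level} {C : PrecubicalSet ℓ} (G : Geometric C) where
  open Geometric G

  face₀≢face₁ : ∀ {k} (s t : Sign) (x : cell C (suc (suc k))) →
                face C (suc k) s zero x ≢ face C (suc k) t (suc zero) x
  face₀≢face₁ s t x eq = εH₀≉εH₁ s t (faces-distinct x (εH s zero idH) (εH t (suc zero) idH) eq)

  faces₀₁-determine : ∀ {k} {s t : Sign} {x x' : cell C (suc (suc k))} →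
                      face C (suc k) s zero x ≡ face C (suc k) s zero x' →
                      face C (suc k) t (suc zero) x ≡ face C (suc k) t (suc zero) x' →
                      x ≡ x'
  faces₀₁-determine {k} {s} {t} {x} {x'} eq₀ eq₁
    with maximal-common x x' (_ , _ , shared-face-common C eq₀)
  ... | _ , w , ((φ , φx≡w) , (φ' , φ'x'≡w)) , maximal
    with maximal _ _ (shared-face-common C eq₀) | maximal _ _ (shared-face-common C eq₁)
  ... | ψ₀ , ψ₀w≡y₀ | ψ₁ , ψ₁w≡y₁ = by-dimension φ φ' ψ₀ ψ₁ φx≡w φ'x'≡w ψ₀w≡y₀ ψ₁w≡y₁
    where
    -- k+1 ≤ dim w ≤ k+2: either w is x (φ = id) or w is the shared face y₀ (ψ₀ = id).
    by-dimension : ∀ {j} {w : cell C j} (φ φ' : Hom j (suc (suc k))) (ψ₀ ψ₁ : Hom (suc k) j) →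
                   act C φ x ≡ w → act C φ' x' ≡ w →
                   act C ψ₀ w ≡ face C (suc k) s zero x →
                   act C ψ₁ w ≡ face C (suc k) t (suc zero) x → x ≡ x'
    by-dimension idH φ' _ _ x≡w φ'x'≡w _ _ = trans x≡w (trans (sym φ'x'≡w) (act-endo C φ' x'))
    by-dimension {w = w} (εH _ _ _) _ idH ψ₁ _ _ w≡y₀ ψ₁w≡y₁ = ⊥-elim (face₀≢face₁ s t x (begin
      face C (suc k) s zero x        ≡⟨ sym w≡y₀ ⟩
      w                              ≡⟨ sym (act-endo C ψ₁ w) ⟩
      act C ψ₁ w                     ≡⟨ ψ₁w≡y₁ ⟩
      face C (suc k) t (suc zero) x  ∎))
    by-dimension (εH _ _ φ) _ (εH _ _ ψ) _ _ _ _ _ = ⊥-elim (1+n≰n (≤-trans (Hom-dim-≤ φ) (Hom-dim-≤ ψ)))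

Cube-dim-≤ : ∀ {k n} → Cube k n → k ≤ n
Cube-dim-≤ []       = z≤n
Cube-dim-≤ (v ∷0)   = s≤s (Cube-dim-≤ v)
Cube-dim-≤ (_ ∷s v) = m≤n⇒m≤1+n (Cube-dim-≤ v)

in∂⇒dim< : ∀ {k n} (v : Cube k n) → T (in∂ v) → k < n
in∂⇒dim< (v ∷0)   p = s≤s (in∂⇒dim< v p)
in∂⇒dim< (_ ∷s v) _ = s≤s (Cube-dim-≤ v)

dim<⇒in∂ : ∀ {k n} (v : Cube k n) → k < n → T (in∂ v)
dim<⇒in∂ (v ∷0)   (s≤s k<n) = dim<⇒in∂ v k<n
dim<⇒in∂ (_ ∷s _) _         = tt

cube-coface : ∀ {k n} (v : Cube k n) → k < n → Coface (Y n) v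
cube-coface (s ∷s v) _ = coface s zero (v ∷0) refl
cube-coface (v ∷0) (s≤s k<n) with cube-coface v k<n
... | coface s i v' refl = coface s (suc i) (v' ∷0) refl

signEq-refl : ∀ s → T (signEq s s)
signEq-refl minus = tt
signEq-refl plus  = tt

agreeing-face : ∀ {k n} (u : Vec Sign n) (i : Fin (suc k)) (v : Cube (suc k) n) →
                ∃[ s ] T (hasAgreement u (cubeFace s i v))
agreeing-face (a ∷ u) i (t ∷s v) with agreeing-face u i v
... | s , agree = s , Equivalence.from T-∨ (inj₂ agree)
agreeing-face (a ∷ u) zero (v ∷0) = a , Equivalence.from T-∨ (inj₁ (signEq-refl a))
agreeing-face {suc k} (a ∷ u) (suc i) (v ∷0) = agreeing-face u i v

∂Y-cell-≡ : ∀ {n k} {v : Cube k n} {p q : T (in∂ v)} → _≡_ {A = cell (∂Y n) k} (v , p) (v , q)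
∂Y-cell-≡ {p = p} {q} = cong (_ ,_) (T-irrelevant p q)

∂Y-coface : ∀ {n k} (c : cell (∂Y n) k) → suc k < n → Coface (∂Y n) c
∂Y-coface (v , _) k+1<n with cube-coface v (<⇒≤ k+1<n)
... | coface s i v' refl = coface s i (v' , dim<⇒in∂ v' k+1<n) ∂Y-cell-≡

module _ {ℓ ℓ' : Level} {D : PrecubicalSet ℓ} {C : PrecubicalSet ℓ'} (g₁ g₂ : Morphism D C) where

  agree-on-face : ∀ {k} (s : Sign) (i : Fin (suc k)) (c : cell D (suc k)) →
                  map g₁ (suc k) c ≡ map g₂ (suc k) c →
                  map g₁ k (face D k s i c) ≡ map g₂ k (face D k s i c)
  agree-on-face {k} s i c eq = begin
    map g₁ k (face D k s i c)        ≡⟨ comm g₁ k s i c ⟩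
    face C k s i (map g₁ (suc k) c)  ≡⟨ cong (face C k s i) eq ⟩
    face C k s i (map g₂ (suc k) c)  ≡⟨ sym (comm g₂ k s i c) ⟩
    map g₂ k (face D k s i c)        ∎

  images-share-face : ∀ {k} (s : Sign) (i : Fin (suc k)) (c : cell D (suc k)) →
                      map g₁ k (face D k s i c) ≡ map g₂ k (face D k s i c) →
                      face C k s i (map g₁ (suc k) c) ≡ face C k s i (map g₂ (suc k) c)
  images-share-face {k} s i c eq = begin
    face C k s i (map g₁ (suc k) c)  ≡⟨ sym (comm g₁ k s i c) ⟩
    map g₁ k (face D k s i c)        ≡⟨ eq ⟩
    map g₂ k (face D k s i c)        ≡⟨ comm g₂ k s i c ⟩
    face C k s i (map g₂ (suc k) c)  ∎

module _ {ℓ : Level} {C : PrecubicalSet ℓ} {N : ℕ} (g₁ g₂ : Morphism (∂Y (suc N)) C) where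

  agree-below-top : (∀ c → map g₁ N c ≡ map g₂ N c) →
                    (k : ℕ) (c : cell (∂Y (suc N)) k) → map g₁ k c ≡ map g₂ k c
  agree-below-top agree-top k c@(v , p) with in∂⇒dim< v p
  ... | s≤s k≤N = agree-at-codim (N ∸ k) (m∸n+n≡m k≤N) c
    where
    agree-at-codim : ∀ d {k} → d + k ≡ N → (c : cell (∂Y (suc N)) k) → map g₁ k c ≡ map g₂ k c
    agree-at-codim zero    refl c = agree-top c
    agree-at-codim (suc d) {k} eq c
      with ∂Y-coface c (s≤s (≤-trans (m≤n+m (suc k) d) (≤-reflexive (trans (+-suc d k) eq))))
    ... | coface s i c' refl = agree-on-face g₁ g₂ s i c' (agree-at-codim d (trans (+-suc d k) eq) c')

module _ {ℓ : Level} {C : PrecubicalSet ℓ} {n : ℕ} (u : Vec Sign n) (f : Morphism (Λ n u) C)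
         (g₁ g₂ : Morphism (∂Y n) C) (e₁ : Extends u f g₁) (e₂ : Extends u f g₂) where

  extensions-agree-on-Λ : ∀ {k} (c : cell (∂Y n) k) → T (hasAgreement u (proj₁ c)) →
                          map g₁ k c ≡ map g₂ k c
  extensions-agree-on-Λ {k} c@(v , p) agree = begin
    map g₁ k c          ≡⟨ cong (map g₁ k) ∂Y-cell-≡ ⟩
    map g₁ k _          ≡⟨ e₁ k (v , c∈Λ) ⟩
    map f k (v , c∈Λ)   ≡⟨ sym (e₂ k (v , c∈Λ)) ⟩
    map g₂ k _          ≡⟨ cong (map g₂ k) ∂Y-cell-≡ ⟩
    map g₂ k c          ∎
    where
    c∈Λ : T (inΛ u v)
    c∈Λ = Equivalence.from T-∧ (p , agree)

extensions-agree-on-top : ∀ {ℓ} {C : PrecubicalSet ℓ} → Geometric C →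
                          ∀ {m} (u : Vec Sign (suc (suc (suc m)))) (f : Morphism (Λ _ u) C)
                          (g₁ g₂ : Morphism (∂Y (suc (suc (suc m)))) C) →
                          Extends u f g₁ → Extends u f g₂ →
                          (c : cell (∂Y (suc (suc (suc m)))) (suc (suc m))) →
                          map g₁ (suc (suc m)) c ≡ map g₂ (suc (suc m)) c
extensions-agree-on-top {C = C} G {m} u f g₁ g₂ e₁ e₂ c@(v , _)
  with agreeing-face u zero v | agreeing-face u (suc zero) v
... | s , agree₀ | t , agree₁ =
  faces₀₁-determine G {s = s} {t} (face-in-Λ-shared s zero agree₀) (face-in-Λ-shared t (suc zero) agree₁)
  where
  face-in-Λ-shared : ∀ s i → T (hasAgreement u (cubeFace s i v)) →
                     face C (suc m) s i (map g₁ (suc (suc m)) c)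
                       ≡ face C (suc m) s i (map g₂ (suc (suc m)) c)
  face-in-Λ-shared s i agree =
    images-share-face g₁ g₂ s i c
      (extensions-agree-on-Λ u f g₁ g₂ e₁ e₂ (face (∂Y _) (suc m) s i c) agree)

lemma1p41 : {ℓ : Level} (C : PrecubicalSet ℓ) → Geometric C →
            (n : ℕ) → 3 ≤ n → (u : Vec Sign n) →
            (f : Morphism (Λ n u) C) (g₁ g₂ : Morphism (∂Y n) C) →
            Extends u f g₁ → Extends u f g₂ →
            (k : ℕ) (c : cell (∂Y n) k) → map g₁ k c ≡ map g₂ k c
lemma1p41 C G (suc (suc (suc m))) (s≤s (s≤s (s≤s _))) u f g₁ g₂ e₁ e₂ =
  agree-below-top g₁ g₂ (extensions-agree-on-top G u f g₁ g₂ e₁ e₂)
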